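{- Let $\Sigma$ be a finite filtration-ready set of formulas and $\mathcal{M}^f$ the filtration of the canonical model through $\Sigma$. Then $R^f_{\mathsf{Agt}}$ and, for every $i\in\mathsf{Agt}$, $R^f_{[i]}$ are equivalence relations on $S^f$.
   Context: Fix a finite non-empty set of agents $\mathsf{Agt}$ and a countably infinite set $\mathsf{Prop}$. $\mathcal{L}_{\mathrm{DTDS}}$: $\varphi::=p\mid\neg\varphi\mid(\varphi\land\varphi)\mid\Box\varphi\mid[i]\varphi\mid[\mathsf{Agt}]\varphi\mid\mathsf{O}_i\varphi\mid\mathsf{X}\varphi\mid\mathsf{U}(\varphi,\varphi)$. $\mathsf{L}_{\mathrm{DTDS}}$ is the smallest set of formulas containing all instances (for all $i$) of: propositional tautologies; K,T,4,5 for $\Box,[i],[\mathsf{Agt}]$; K for $\mathsf{O}_i,\mathsf{X}$; $\Box\varphi\to[i]\varphi$; $\bigwedge_i\Diamond[i]\varphi_i\to\Diamond\bigwedge_i[i]\varphi_i$; $\bigwedge_i[i]\varphi_i\to[\mathsf{Agt}]\bigwedge_i\varphi_i$; $[\mathsf{Agt}]\mathsf{X}\varphi\to\mathsf{X}\Box\varphi$; $\Box\varphi\to\mathsf{O}_i\varphi$; $\mathsf{O}_i\varphi\to\neg\mathsf{O}_i\neg\varphi$; $\mathsf{O}_i\varphi\to\mathsf{O}_i[i]\varphi$; $\mathsf{O}_i\varphi\to\Box\mathsf{O}_i\varphi$; $\mathsf{X}\varphi\leftrightarrow\neg\mathsf{X}\neg\varphi$; $\mathsf{U}(\varphi,\psi)\leftrightarrow(\varphi\lor(\psi\land\mathsf{X}\mathsf{U}(\varphi,\psi)))$;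 closed under modus ponens, necessitation for $\Box,[\mathsf{Agt}],\mathsf{X},[i],\mathsf{O}_i$, and: from $\chi\to(\neg\varphi\land\mathsf{X}\chi)$ infer $\chi\to\neg\mathsf{U}(\varphi,\psi)$. Canonical model: $S^c$ = maximal $\mathsf{L}_{\mathrm{DTDS}}$-consistent sets; for $O\in\{\Box,[\mathsf{Agt}]\}\cup\{[i],\mathsf{O}_i\mid i\in\mathsf{Agt}\}$, $wR^c_Ov$ iff $\varphi\in v$ whenever $O\varphi\in w$; $w\to^cv$ iff $\varphi\in v$ whenever $\mathsf{X}\varphi\in w$. $\Sigma$ is filtration-ready if closed under subformulas; closed under $\dot\neg$ ($\dot\neg\neg\psi=\psi$, $\dot\neg\psi=\neg\psi$ otherwise); $\mathsf{U}(\alpha,\beta)\in\Sigma\Rightarrow\mathsf{X}\mathsf{U}(\alpha,\beta)\in\Sigma$; $\mathsf{O}_i\varphi\in\Sigma\Rightarrow[i]\varphi\in\Sigma$. Filtration $\mathcal{M}^f$: $\Sigma(w)=w\cap\Sigma$; $w\sim v$ iff $\Sigma(w)=\Sigma(v)$ and $\{\Sigma(x)\mid wR^c_\Box x\}=\{\Sigma(x)\mid vR^c_\Box x\}$; $|w|$ is the $\sim$-class of $w$ and $S^f$ the set of $\sim$-classes. For each operator $O$, $CR^e_OD$ iff there are $w\in C$, $v\in D$ with $wR^c_Ov$. $R^f_\Box=R^e_\Box$; $C\to^fD$ iff there are $w\in C,v\in D$ with $w\to^cv$; $R^f_{\mathsf{Agt}}$ and $R^f_{[i]}$ are the transitive closures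 of $R^e_{[\mathsf{Agt}]}$ and $R^e_{[i]}$; $R^f_{\mathsf{O}_i}=R^e_{\mathsf{O}_i}\circ R^f_{[i]}$ (composition: $x(R\circ R')y$ iff $xRz$, $zR'y$ for some $z$). -}

module Defs where

open import Data.Nat using (ℕ; zero; suc)
open import Data.Fin using (Fin; zero; suc)
open import Data.Bool using (Bool; true; false; not; _∧_)
open import Data.List using (List; []; _∷_)
open import Data.List.Membership.Propositional using (_∈_)
open import Data.List.Relation.Unary.All using (All)
open import Data.Product using (Σ; _×_; _,_; ∃)
open import Data.Sum using (_⊎_)
open import Relation.Binary.PropositionalEquality using (_≡_)
open import Relation.Nullary using (¬_)
open import Level using (Level) renaming (suc to lsuc; zero to lzero)
open import Relation.Binary.Construct.Closure.Transitive using (TransClosure)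

-- Language L_DTDS.  Agt = Fin (suc m) (finite, non-empty); Prop = ℕ.

data Fm (m : ℕ) : Set where
  var   : ℕ → Fm m
  ¬'_   : Fm m → Fm m
  _∧'_  : Fm m → Fm m → Fm m
  □     : Fm m → Fm m
  [_]   : Fin (suc m) → Fm m → Fm m
  [Agt] : Fm m → Fm m
  O     : Fin (suc m) → Fm m → Fm m
  X     : Fm m → Fm m
  U     : Fm m → Fm m → Fm m

infix 7 ¬'_
infixr 6 _∧'_

module _ {m : ℕ} where

  infixr 5 _∨'_
  infixr 4 _⇒_ _⇔_

  _∨'_ : Fm m → Fm m → Fm m
  φ ∨' ψ = ¬' (¬' φ ∧' ¬' ψ)

  _⇒_ : Fm m → Fm m → Fm m
  φ ⇒ ψ = ¬' (φ ∧' ¬' ψ)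

  _⇔_ : Fm m → Fm m → Fm m
  φ ⇔ ψ = (φ ⇒ ψ) ∧' (ψ ⇒ φ)

  ◇ : Fm m → Fm m
  ◇ φ = ¬' □ (¬' φ)

  ⊥' : Fm m
  ⊥' = var 0 ∧' ¬' var 0

  ⊤' : Fm m
  ⊤' = ¬' ⊥'

  ⋀Agt : ∀ {k} → (Fin (suc k) → Fm m) → Fm m
  ⋀Agt {zero}  f = f zero
  ⋀Agt {suc k} f = f zero ∧' ⋀Agt {k} (λ i → f (suc i))

  ⋀ : List (Fm m) → Fm m
  ⋀ []       = ⊤'
  ⋀ (φ ∷ φs) = φ ∧' ⋀ φs

  -- Propositional tautologies (instances): formulas true under every
  -- Boolean valuation treating non-Boolean subformulas as atoms.
  eval : (Fm m → Bool) → Fm m → Bool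
  eval v (¬' φ)   = not (eval v φ)
  eval v (φ ∧' ψ) = eval v φ ∧ eval v ψ
  eval v φ        = v φ

  Taut : Fm m → Set
  Taut φ = (v : Fm m → Bool) → eval v φ ≡ true

  data Op : Set where
    op□   : Op
    op[_] : Fin (suc m) → Op
    opAgt : Op
    opO   : Fin (suc m) → Op
    opX   : Op

  box : Op → Fm m → Fm m
  box op□      = □
  box op[ i ]  = [ i ]
  box opAgt    = [Agt]
  box (opO i)  = O i
  box opX      = X

  data S5Op : Op → Set where
    s5□   : S5Op op□
    s5i   : ∀ i → S5Op op[ i ]
    s5Agt : S5Op opAgt

  data Thm : Fm m → Set where
    taut   : ∀ {φ} → Taut φ → Thm φ
    axK    : ∀ o φ ψ → Thm (box o (φ ⇒ ψ) ⇒ (box o φ ⇒ box o ψ))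
    axT    : ∀ {o} → S5Op o → ∀ φ → Thm (box o φ ⇒ φ)
    ax4    : ∀ {o} → S5Op o → ∀ φ → Thm (box o φ ⇒ box o (box o φ))
    ax5    : ∀ {o} → S5Op o → ∀ φ → Thm (¬' box o φ ⇒ box o (¬' box o φ))
    axSett : ∀ i φ → Thm (□ φ ⇒ [ i ] φ)
    axIA   : (φ : Fin (suc m) → Fm m) →
             Thm (⋀Agt (λ i → ◇ ([ i ] (φ i))) ⇒ ◇ (⋀Agt (λ i → [ i ] (φ i))))
    axGrp  : (φ : Fin (suc m) → Fm m) →
             Thm (⋀Agt (λ i → [ i ] (φ i)) ⇒ [Agt] (⋀Agt φ))
    axNCUH : ∀ φ → Thm ([Agt] (X φ) ⇒ X (□ φ))
    axOb1  : ∀ i φ → Thm (□ φ ⇒ O i φ)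
    axOb2  : ∀ i φ → Thm (O i φ ⇒ ¬' O i (¬' φ))
    axOb3  : ∀ i φ → Thm (O i φ ⇒ O i ([ i ] φ))
    axOb4  : ∀ i φ → Thm (O i φ ⇒ □ (O i φ))
    axFun  : ∀ φ → Thm (X φ ⇔ ¬' X (¬' φ))
    axU    : ∀ φ ψ → Thm (U φ ψ ⇔ (φ ∨' (ψ ∧' X (U φ ψ))))
    mp     : ∀ {φ ψ} → Thm (φ ⇒ ψ) → Thm φ → Thm ψ
    nec    : ∀ o {φ} → Thm φ → Thm (box o φ)
    indU   : ∀ {χ φ ψ} → Thm (χ ⇒ (¬' φ ∧' X χ)) → Thm (χ ⇒ ¬' U φ ψ)

  Subset : Set₁
  Subset = Fm m → Set

  Consistent : Subset → Set
  Consistent Γ = ¬ (Σ (List (Fm m)) λ φs → All Γ φs × Thm (¬' ⋀ φs))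

  Maximal : Subset → Set
  Maximal Γ = Consistent Γ ×
              ((φ : Fm m) → Consistent (λ ψ → Γ ψ ⊎ ψ ≡ φ) → Γ φ)

  Sᶜ : Set₁
  Sᶜ = Σ Subset Maximal

  _∋_ : Sᶜ → Fm m → Set
  (Γ , _) ∋ φ = Γ φ

  Rᶜ : Op → Sᶜ → Sᶜ → Set
  Rᶜ o w v = ∀ φ → w ∋ box o φ → v ∋ φ

  data ImmSub : Fm m → Fm m → Set where
    s¬   : ∀ {φ} → ImmSub φ (¬' φ)
    s∧l  : ∀ {φ ψ} → ImmSub φ (φ ∧' ψ)
    s∧r  : ∀ {φ ψ} → ImmSub ψ (φ ∧' ψ)
    s□   : ∀ {φ} → ImmSub φ (□ φ)
    si   : ∀ {i φ} → ImmSub φ ([ i ] φ)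
    sAgt : ∀ {φ} → ImmSub φ ([Agt] φ)
    sO   : ∀ {i φ} → ImmSub φ (O i φ)
    sX   : ∀ {φ} → ImmSub φ (X φ)
    sUl  : ∀ {φ ψ} → ImmSub φ (U φ ψ)
    sUr  : ∀ {φ ψ} → ImmSub ψ (U φ ψ)

  ¬̇ : Fm m → Fm m
  ¬̇ (¬' ψ) = ψ
  ¬̇ ψ      = ¬' ψ

  record FiltrationReady (Γ : List (Fm m)) : Set where
    field
      subClosed : ∀ {φ ψ} → φ ∈ Γ → ImmSub ψ φ → ψ ∈ Γ
      negClosed : ∀ {φ} → φ ∈ Γ → ¬̇ φ ∈ Γ
      UClosed   : ∀ {φ ψ} → U φ ψ ∈ Γ → X (U φ ψ) ∈ Γ
      OClosed   : ∀ {i φ} → O i φ ∈ Γ → [ i ] φ ∈ Γ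

  -- Filtration through a finite set Γ (given as a list).
  -- Elements of Sᶠ (∼-classes) are represented by elements of Sᶜ;
  -- the relations below are ∼-invariant by construction.

  SameΣ : List (Fm m) → Sᶜ → Sᶜ → Set
  SameΣ Γ w v = ∀ φ → φ ∈ Γ → (w ∋ φ → v ∋ φ) × (v ∋ φ → w ∋ φ)

  _⊢_∼_ : List (Fm m) → Sᶜ → Sᶜ → Set₁
  Γ ⊢ w ∼ v = SameΣ Γ w v ×
              (∀ x → Rᶜ op□ w x → ∃ λ y → Rᶜ op□ v y × SameΣ Γ x y) ×
              (∀ y → Rᶜ op□ v y → ∃ λ x → Rᶜ op□ w x × SameΣ Γ x y)

  Rᵉ : List (Fm m) → Op → Sᶜ → Sᶜ → Set₁
  Rᵉ Γ o w v = ∃ λ w' → ∃ λ v' → (Γ ⊢ w ∼ w') × (Γ ⊢ v ∼ v') × Rᶜ o w' v'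

  Rᶠ-Agt : List (Fm m) → Sᶜ → Sᶜ → Set₁
  Rᶠ-Agt Γ = TransClosure (Rᵉ Γ opAgt)

  Rᶠ-[_] : List (Fm m) → Fin (suc m) → Sᶜ → Sᶜ → Set₁
  Rᶠ-[ Γ ] i = TransClosure (Rᵉ Γ op[ i ])

{-# OPTIONS --safe #-}
-- For □, [i] and [Agt] the canonical relation is reflexive by axiom T and
-- symmetric because T and 5 together give ¬φ → □¬□φ, as in any S5 canonical
-- model.  Reflexivity and symmetry survive the existential lifting Rᵉ to
-- ∼-classes, and the transitive closure of a reflexive symmetric relation is
-- an equivalence.
module Submission where

open import Defs
open import Data.Bool using (Bool; true; false; not; _∧_; T)
open import Data.Bool.Properties using (T-≡; T-∧; ∧-inverseʳ)
open import Data.Fin using (Fin; fromℕ<)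
open import Data.List using (List; []; _∷_)
open import Data.List.Relation.Unary.All using (All; []; _∷_)
open import Data.Nat using (ℕ; zero; suc; _<?_)
open import Data.Product using (_×_; _,_; proj₁; proj₂; ∃-syntax)
open import Data.Sum using (_⊎_; inj₁; inj₂)
open import Data.Vec using (Vec; []; _∷_; lookup; map)
open import Data.Vec.Properties using (lookup-map)
open import Function using (_∘_; id)
open import Function.Bundles using (Equivalence)
open import Relation.Binary.Core using (Rel)
open import Relation.Binary.PropositionalEquality using (_≡_; refl; sym; trans; cong; cong₂)
open import Relation.Binary.Structures using (IsEquivalence)
open import Relation.Binary.Construct.Closure.Transitive as Plus using (TransClosure)
open import Relation.Nullary using (¬_)
open import Relation.Nullary.Decidable using (True; toWitness)

TransClosure-isEquivalence : ∀ {a ℓ} {A : Set a} {R : Rel A ℓ} →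
  (∀ x → R x x) → (∀ x y → R x y → R y x) → IsEquivalence (TransClosure R)
TransClosure-isEquivalence {R = R} R-refl R-sym = record
  { refl  = λ {x} → Plus.[ R-refl x ]
  ; sym   = Plus.symmetric R (λ {x y} → R-sym x y)
  ; trans = Plus.transitive R
  }

infix  7 ¬ˢ_
infixr 6 _∧ˢ_
infixr 4 _⇒ˢ_

data Schema (n : ℕ) : Set where
  atom : Fin n → Schema n
  ⊤ˢ   : Schema n
  ¬ˢ_  : Schema n → Schema n
  _∧ˢ_ : Schema n → Schema n → Schema n

_⇒ˢ_ : ∀ {n} → Schema n → Schema n → Schema n
s ⇒ˢ t = ¬ˢ (s ∧ˢ ¬ˢ t)

#_ : ∀ k {n} {k<n : True (k <? n)} → Schema n
(# k) {k<n = k<n} = atom (fromℕ< (toWitness k<n))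

evalˢ : ∀ {n} → Vec Bool n → Schema n → Bool
evalˢ ρ (atom i) = lookup ρ i
evalˢ ρ ⊤ˢ       = true
evalˢ ρ (¬ˢ s)   = not (evalˢ ρ s)
evalˢ ρ (s ∧ˢ t) = evalˢ ρ s ∧ evalˢ ρ t

allValuations : ∀ n → (Vec Bool n → Bool) → Bool
allValuations zero    f = f []
allValuations (suc n) f =
  allValuations n (f ∘ (true ∷_)) ∧ allValuations n (f ∘ (false ∷_))

allValuations-sound : ∀ n {f : Vec Bool n → Bool} → T (allValuations n f) → ∀ ρ → T (f ρ)
allValuations-sound zero    holds []          = holds
allValuations-sound (suc n) holds (true ∷ ρ)  =
  allValuations-sound n (proj₁ (Equivalence.to T-∧ holds)) ρ
allValuations-sound (suc n) holds (false ∷ ρ) =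
  allValuations-sound n (proj₂ (Equivalence.to T-∧ holds)) ρ

isTautology : ∀ {n} → Schema n → Bool
isTautology {n} s = allValuations n (λ ρ → evalˢ ρ s)

module _ {m : ℕ} where

  instantiate : ∀ {n} → Vec (Fm m) n → Schema n → Fm m
  instantiate σ (atom i) = lookup σ i
  instantiate σ ⊤ˢ       = ⊤'
  instantiate σ (¬ˢ s)   = ¬' instantiate σ s
  instantiate σ (s ∧ˢ t) = instantiate σ s ∧' instantiate σ t

  eval-instantiate : ∀ {n} v (σ : Vec (Fm m) n) s →
    eval v (instantiate σ s) ≡ evalˢ (map (eval v) σ) s
  eval-instantiate v σ (atom i) = sym (lookup-map i (eval v) σ)
  eval-instantiate v σ ⊤ˢ       = cong not (∧-inverseʳ (v (var 0)))
  eval-instantiate v σ (¬ˢ s)   = cong not (eval-instantiate v σ s)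
  eval-instantiate v σ (s ∧ˢ t) = cong₂ _∧_ (eval-instantiate v σ s) (eval-instantiate v σ t)

  -- For a closed valid schema T (isTautology s) computes to ⊤, so valid is inferred.
  tautology : ∀ {n} (s : Schema n) {valid : T (isTautology s)} (σ : Vec (Fm m) n) →
    Thm (instantiate σ s)
  tautology {n} s {valid} σ = taut λ v →
    trans (eval-instantiate v σ s)
          (Equivalence.to T-≡ (allValuations-sound n valid (map (eval v) σ)))

  mp₂ : ∀ {φ ψ χ : Fm m} → Thm (φ ⇒ ψ ⇒ χ) → Thm φ → Thm ψ → Thm χ
  mp₂ ⊢φ⇒ψ⇒χ ⊢φ ⊢ψ = mp (mp ⊢φ⇒ψ⇒χ ⊢φ) ⊢ψ

  contrapositive : ∀ {φ ψ : Fm m} → Thm (φ ⇒ ψ) → Thm (¬' ψ ⇒ ¬' φ)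
  contrapositive {φ} {ψ} = mp (tautology ((# 0 ⇒ˢ # 1) ⇒ˢ ¬ˢ # 1 ⇒ˢ ¬ˢ # 0) (φ ∷ ψ ∷ []))

  discharge : ∀ {Γ : Subset} {χ φs} → All (λ ψ → Γ ψ ⊎ ψ ≡ χ) φs →
    ∃[ ψs ] All Γ ψs × Thm (⋀ ψs ⇒ χ ⇒ ⋀ φs)
  discharge {χ = χ} [] = [] , [] , tautology (⊤ˢ ⇒ˢ # 0 ⇒ˢ ⊤ˢ) (χ ∷ [])
  discharge {χ = χ} {φ ∷ φs} (inj₁ φ∈Γ ∷ rest) =
    let ψs , ψs⊆Γ , ⊢ψs⇒χ⇒φs = discharge rest
    in φ ∷ ψs , φ∈Γ ∷ ψs⊆Γ ,
       mp (tautology ((# 0 ⇒ˢ # 1 ⇒ˢ # 2) ⇒ˢ # 3 ∧ˢ # 0 ⇒ˢ # 1 ⇒ˢ # 3 ∧ˢ # 2)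
                     (⋀ ψs ∷ χ ∷ ⋀ φs ∷ φ ∷ []))
          ⊢ψs⇒χ⇒φs
  discharge {χ = χ} {.χ ∷ φs} (inj₂ refl ∷ rest) =
    let ψs , ψs⊆Γ , ⊢ψs⇒χ⇒φs = discharge rest
    in ψs , ψs⊆Γ ,
       mp (tautology ((# 0 ⇒ˢ # 1 ⇒ˢ # 2) ⇒ˢ # 0 ⇒ˢ # 1 ⇒ˢ # 1 ∧ˢ # 2)
                     (⋀ ψs ∷ χ ∷ ⋀ φs ∷ []))
          ⊢ψs⇒χ⇒φs

  module _ (w : Sᶜ {m}) where

    consistent : ∀ {ψs} → All (w ∋_) ψs → ¬ Thm (¬' ⋀ ψs)
    consistent ψs⊆w ⊢¬ψs = proj₁ (proj₂ w) (_ , ψs⊆w , ⊢¬ψs)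

    ∋-intro : ∀ {χ} → (∀ {ψs} → All (w ∋_) ψs → ¬ Thm (⋀ ψs ⇒ ¬' χ)) → w ∋ χ
    ∋-intro {χ} refute = proj₂ (proj₂ w) χ λ (φs , φs⊆w,χ , ⊢¬φs) →
      let ψs , ψs⊆w , ⊢ψs⇒χ⇒φs = discharge φs⊆w,χ
      in refute ψs⊆w
           (mp₂ (tautology ((# 0 ⇒ˢ # 1 ⇒ˢ # 2) ⇒ˢ ¬ˢ # 2 ⇒ˢ # 0 ⇒ˢ ¬ˢ # 1)
                           (⋀ ψs ∷ χ ∷ ⋀ φs ∷ []))
                ⊢ψs⇒χ⇒φs ⊢¬φs)

    ∋-closed : ∀ {φ ψ} → Thm (φ ⇒ ψ) → w ∋ φ → w ∋ ψ
    ∋-closed {φ} {ψ} ⊢φ⇒ψ φ∈w = ∋-intro λ {ψs} ψs⊆w ⊢ψs⇒¬ψ →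
      consistent (φ∈w ∷ ψs⊆w)
        (mp₂ (tautology ((# 0 ⇒ˢ # 1) ⇒ˢ (# 2 ⇒ˢ ¬ˢ # 1) ⇒ˢ ¬ˢ (# 0 ∧ˢ # 2))
                        (φ ∷ ψ ∷ ⋀ ψs ∷ []))
             ⊢φ⇒ψ ⊢ψs⇒¬ψ)

    ∋-⊤ : w ∋ ⊤'
    ∋-⊤ = ∋-intro λ {ψs} ψs⊆w ⊢ψs⇒¬⊤ →
      consistent ψs⊆w (mp (tautology ((# 0 ⇒ˢ ¬ˢ ⊤ˢ) ⇒ˢ ¬ˢ # 0) (⋀ ψs ∷ [])) ⊢ψs⇒¬⊤)

    ∋-∧ : ∀ {φ ψ} → w ∋ φ → w ∋ ψ → w ∋ (φ ∧' ψ)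
    ∋-∧ {φ} {ψ} φ∈w ψ∈w = ∋-intro λ {ψs} ψs⊆w ⊢ψs⇒¬φ∧ψ →
      consistent (φ∈w ∷ ψ∈w ∷ ψs⊆w)
        (mp (tautology ((# 2 ⇒ˢ ¬ˢ (# 0 ∧ˢ # 1)) ⇒ˢ ¬ˢ (# 0 ∧ˢ # 1 ∧ˢ # 2))
                       (φ ∷ ψ ∷ ⋀ ψs ∷ []))
            ⊢ψs⇒¬φ∧ψ)

    ∋-⋀ : ∀ {ψs} → All (w ∋_) ψs → w ∋ (⋀ ψs)
    ∋-⋀ []           = ∋-⊤
    ∋-⋀ (ψ∈w ∷ ψs⊆w) = ∋-∧ ψ∈w (∋-⋀ ψs⊆w)

    ∋¬⇒∌ : ∀ {φ} → w ∋ (¬' φ) → ¬ w ∋ φ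
    ∋¬⇒∌ {φ} ¬φ∈w φ∈w =
      consistent (φ∈w ∷ ¬φ∈w ∷ []) (tautology (¬ˢ (# 0 ∧ˢ ¬ˢ # 0 ∧ˢ ⊤ˢ)) (φ ∷ []))

    ∌¬⇒∋ : ∀ {φ} → ¬ w ∋ (¬' φ) → w ∋ φ
    ∌¬⇒∋ ¬φ∉w = ∋-intro λ ψs⊆w ⊢ψs⇒¬φ → ¬φ∉w (∋-closed ⊢ψs⇒¬φ (∋-⋀ ψs⊆w))

  Rᶜ-refl : ∀ {o : Op {m}} → S5Op o → ∀ w → Rᶜ o w w
  Rᶜ-refl s5 w φ = ∋-closed w (axT s5 φ)

  Rᶜ-sym : ∀ {o : Op {m}} → S5Op o → ∀ w v → Rᶜ o w v → Rᶜ o v w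
  Rᶜ-sym {o} s5 w v wRv φ □φ∈v = ∌¬⇒∋ w λ ¬φ∈w →
    let ¬□φ∈w = ∋-closed w (contrapositive (axT s5 φ)) ¬φ∈w
    in ∋¬⇒∌ v (wRv (¬' box o φ) (∋-closed w (ax5 s5 φ) ¬□φ∈w)) □φ∈v

  SameΣ-refl : (Γ : List (Fm m)) → ∀ w → SameΣ Γ w w
  SameΣ-refl Γ w φ _ = id , id

  ∼-refl : (Γ : List (Fm m)) → ∀ w → Γ ⊢ w ∼ w
  ∼-refl Γ w = SameΣ-refl Γ w
             , (λ x wRx → x , wRx , SameΣ-refl Γ x)
             , (λ x wRx → x , wRx , SameΣ-refl Γ x)

  Rᵉ-refl : ∀ {Γ : List (Fm m)} {o} → (∀ w → Rᶜ o w w) → ∀ w → Rᵉ Γ o w w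
  Rᵉ-refl {Γ} R-refl w = w , w , ∼-refl Γ w , ∼-refl Γ w , R-refl w

  Rᵉ-sym : ∀ {Γ : List (Fm m)} {o} →
    (∀ w v → Rᶜ o w v → Rᶜ o v w) → ∀ w v → Rᵉ Γ o w v → Rᵉ Γ o v w
  Rᵉ-sym R-sym _ _ (w′ , v′ , w∼w′ , v∼v′ , w′Rv′) =
    v′ , w′ , v∼v′ , w∼w′ , R-sym w′ v′ w′Rv′

  Rᶠ-isEquivalence : ∀ {Γ : List (Fm m)} {o} → S5Op o →
    IsEquivalence (TransClosure (Rᵉ Γ o))
  Rᶠ-isEquivalence s5 =
    TransClosure-isEquivalence (Rᵉ-refl (Rᶜ-refl s5)) (Rᵉ-sym (Rᶜ-sym s5))

proposition11 : (m : ℕ) (Γ : List (Fm m)) → FiltrationReady Γ →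
    IsEquivalence (Rᶠ-Agt Γ) × ((i : Fin (suc m)) → IsEquivalence (Rᶠ-[ Γ ] i))
proposition11 m Γ _ = Rᶠ-isEquivalence s5Agt , λ i → Rᶠ-isEquivalence (s5i i)
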